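{- Let $(\mathcal{A},\mathcal{D})$ be a duality pair of finite directed graphs with $\mathcal{A}$ an antichain consisting of cores and $\mathcal{D}$ finite. Then every vertex of every graph $A\in\mathcal{A}$ has total degree (in-degree plus out-degree) at most $d_0=\sum_{D\in\mathcal{D}}|V(D)|$.
   Context: A (finite directed) graph is a pair $(V,E)$ with $V$ finite and $E\subseteq V^2$. A homomorphism $f:G\to H$ is a map $V(G)\to V(H)$ sending edges to edges; $G\to H$ means one exists. A core is a graph all of whose endomorphisms are isomorphisms. A family of graphs is an antichain if there is no homomorphism between any two distinct members. A duality pair is a pair $(\mathcal{A},\mathcal{D})$ of families of graphs such that for every graph $G$ exactly one holds: $A\to G$ for some $A\in\mathcal{A}$, or $G\to D$ for some $D\in\mathcal{D}$. -}

module Defs where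

open import Data.Nat using (ℕ; _+_)
open import Data.Bool using (Bool; true; false; if_then_else_)
open import Data.Fin using (Fin)
open import Data.Vec using (Vec; lookup)
open import Data.List using (List; map; allFin)
open import Data.Nat.ListAction using (sum)
open import Data.List.Membership.Propositional using (_∈_)
open import Data.Product using (Σ; _×_; ∃-syntax)
open import Data.Sum using (_⊎_)
open import Relation.Nullary using (¬_)
open import Relation.Binary.PropositionalEquality using (_≡_)

-- A finite directed graph: vertex set Fin size, edge relation given by an
-- adjacency matrix (adj ! u ! v ≡ true  iff  (u,v) ∈ E).  Loops allowed.
record Graph : Set where
  constructor mkGraph
  field
    size : ℕ
    adj  : Vec (Vec Bool size) size

open Graph public

V : Graph → Set
V G = Fin (size G)

Edge : (G : Graph) → V G → V G → Set
Edge G u v = lookup (lookup (adj G) u) v ≡ true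

IsHom : (G H : Graph) → (V G → V H) → Set
IsHom G H f = ∀ u v → Edge G u v → Edge H (f u) (f v)

_⟶_ : Graph → Graph → Set
G ⟶ H = Σ (V G → V H) (IsHom G H)

IsIso : (G H : Graph) → (V G → V H) → Set
IsIso G H f = IsHom G H f × Σ (V H → V G) λ g →
  IsHom H G g × (∀ x → g (f x) ≡ x) × (∀ y → f (g y) ≡ y)

IsCore : Graph → Set
IsCore G = ∀ (f : V G → V G) → IsHom G G f → IsIso G G f

Family : Set₁
Family = Graph → Set

IsAntichain : Family → Set
IsAntichain 𝒜 = ∀ A B → 𝒜 A → 𝒜 B → ¬ (A ≡ B) → ¬ (A ⟶ B)

IsDualityPair : Family → List Graph → Set
IsDualityPair 𝒜 𝒟 = ∀ (G : Graph) →
  let X = ∃[ A ] (𝒜 A × (A ⟶ G))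
      Y = ∃[ D ] (D ∈ 𝒟 × (G ⟶ D))
  in (X ⊎ Y) × ¬ (X × Y)

indicator : Bool → ℕ
indicator b = if b then 1 else 0

outDeg : (G : Graph) → V G → ℕ
outDeg G v = sum (map (λ u → indicator (lookup (lookup (adj G) v) u)) (allFin (size G)))

inDeg : (G : Graph) → V G → ℕ
inDeg G v = sum (map (λ u → indicator (lookup (lookup (adj G) u) v)) (allFin (size G)))

totalDeg : (G : Graph) → V G → ℕ
totalDeg G v = inDeg G v + outDeg G v

d₀ : List Graph → ℕ
d₀ 𝒟 = sum (map size 𝒟)

-- Split a vertex v of A ∈ 𝒜 into one copy per arc at v, each copy lacking its own arc; the
-- resulting graph folds onto A. A homomorphism from A to it would, composed with the fold, be an
-- automorphism of the core A, hence give a section of the fold, which must send v to a copy of v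
-- lacking an arc of v: impossible. As 𝒜 is an antichain, no member of 𝒜 maps to the split graph
-- either, so by duality it maps to some D ∈ 𝒟. Two copies of v with the same image in D could be
-- identified into a homomorphism A → D, which duality forbids; so the arcs at v inject into V(D).
module Submission where

open import Defs
open import Data.Nat using (ℕ; _≤_; _+_; z≤n)
import Data.Nat as ℕ
open import Data.Nat.Properties using (≤-trans; m≤m+n; m≤n+m)
open import Data.Nat.ListAction using (sum)
open import Data.Nat.ListAction.Properties using (sum-++)
open import Data.Bool using (Bool; true; false) renaming (_≟_ to _≟ᵇ_)
open import Data.Fin using (Fin; zero; suc; splitAt; join) renaming (_≟_ to _≟ᶠ_)
open import Data.Fin.Properties using (injective⇒≤; splitAt-join)
open import Data.Vec using (tabulate; lookup)
open import Data.Vec.Properties using (lookup∘tabulate)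
open import Data.List using (List; []; _∷_; _++_; map; filter; length; allFin)
import Data.List as List
open import Data.List.Properties using (map-∘; map-++)
open import Data.List.Relation.Unary.All using (_∷_)
import Data.List.Relation.Unary.All as All
open import Data.List.Relation.Unary.All.Properties using (all-filter)
open import Data.List.Relation.Unary.Any using (here; there)
open import Data.List.Relation.Unary.Unique.Propositional using (Unique; _∷_)
import Data.List.Relation.Unary.Unique.Propositional.Properties as Unique
open import Data.List.Membership.Propositional using (_∈_)
open import Data.List.Membership.Propositional.Properties using (∈-lookup; ∈-map⁻)
open import Data.Product using (Σ-syntax; ∃-syntax; _×_; _,_; proj₁; proj₂)
open import Data.Sum using (_⊎_; inj₁; inj₂)
import Data.Sum as Sum
open import Data.Sum.Properties using (≡-dec; inj₁-injective; inj₂-injective)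
open import Data.Empty using (⊥-elim)
open import Function using (_∘_)
open import Relation.Unary using (Pred; Decidable)
open import Relation.Binary.Definitions using (DecidableEquality)
open import Relation.Nullary using (¬_; Dec; yes; no; does)
open import Relation.Nullary.Decidable using (¬?; _×-dec_; dec-true)
open import Relation.Binary.PropositionalEquality
  using (_≡_; _≢_; refl; sym; trans; cong; cong₂; subst; subst₂; module ≡-Reasoning)

Unique⇒lookup-injective : ∀ {a} {X : Set a} {xs : List X} → Unique xs →
                          ∀ {i j} → List.lookup xs i ≡ List.lookup xs j → i ≡ j
Unique⇒lookup-injective (_ ∷ _)    {zero}  {zero}  _  = refl
Unique⇒lookup-injective (x∉xs ∷ _) {zero}  {suc j} eq = ⊥-elim (All.lookup x∉xs (∈-lookup j) eq)
Unique⇒lookup-injective (x∉xs ∷ _) {suc i} {zero}  eq = ⊥-elim (All.lookup x∉xs (∈-lookup i) (sym eq))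
Unique⇒lookup-injective (_ ∷ u)    {suc i} {suc j} eq = cong suc (Unique⇒lookup-injective u eq)

module _ {a p} {X : Set a} {P : Pred X p} (P? : Decidable P) where

  length-filter≤ : ∀ {m} {xs : List X} (g : X → Fin m) →
                   (∀ {x y} → P x → P y → g x ≡ g y → x ≡ y) →
                   Unique xs → length (filter P? xs) ≤ m
  length-filter≤ {xs = xs} g g-injective xs! = injective⇒≤ λ {i} {j} eq →
    Unique⇒lookup-injective (Unique.filter⁺ P? xs!)
      (g-injective (satisfies i) (satisfies j) eq)
    where
    satisfies : ∀ i → P (List.lookup (filter P? xs) i)
    satisfies i = All.lookup (all-filter P? xs) (∈-lookup i)

  length-filter≤-from-witness : ∀ {m} xs → (∀ {x} → P x → length (filter P? xs) ≤ m) →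
                                length (filter P? xs) ≤ m
  length-filter≤-from-witness xs bound with filter P? xs | all-filter P? xs
  ... | []    | _      = z≤n
  ... | _ ∷ _ | px ∷ _ = bound px

sum-indicator≡length-filter : ∀ {a} {X : Set a} (b : X → Bool) xs →
  sum (map (indicator ∘ b) xs) ≡ length (filter (λ x → b x ≟ᵇ true) xs)
sum-indicator≡length-filter b [] = refl
sum-indicator≡length-filter b (x ∷ xs) with b x
... | true  = cong ℕ.suc (sum-indicator≡length-filter b xs)
... | false = sum-indicator≡length-filter b xs

module _ (n : ℕ) {r} {R : Fin n → Fin n → Set r} (R? : ∀ i j → Dec (R i j)) where

  decGraph : Graph
  decGraph = mkGraph n (tabulate λ i → tabulate λ j → does (R? i j))

  private
    adj-decGraph : ∀ i j → lookup (lookup (adj decGraph) i) j ≡ does (R? i j)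
    adj-decGraph i j =
      trans (cong (λ row → lookup row j) (lookup∘tabulate _ i)) (lookup∘tabulate _ j)

  Edge-decGraph⁻ : ∀ {i j} → Edge decGraph i j → R i j
  Edge-decGraph⁻ {i} {j} e with R? i j | trans (sym (adj-decGraph i j)) e
  ... | yes rij | _  = rij
  ... | no _    | ()

  Edge-decGraph⁺ : ∀ {i j} → R i j → Edge decGraph i j
  Edge-decGraph⁺ {i} {j} rij = trans (adj-decGraph i j) (dec-true (R? i j) rij)

idHom : ∀ G → G ⟶ G
idHom G = (λ x → x) , λ _ _ e → e

_⨾_ : ∀ {G H K} → G ⟶ H → H ⟶ K → G ⟶ K
(f , f-hom) ⨾ (g , g-hom) = g ∘ f , λ x y e → g-hom (f x) (f y) (f-hom x y e)

core⇒section : ∀ {A H} → IsCore A → A ⟶ H → (r : H ⟶ A) →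
               Σ[ s ∈ A ⟶ H ] (∀ x → proj₁ r (proj₁ s x) ≡ x)
core⇒section {A} {H} core h r with core _ (proj₂ (_⨾_ {A} {H} {A} h r))
... | _ , γ , γ-hom , _ , rhγ≡id = _⨾_ {A} {A} {H} (γ , γ-hom) h , rhγ≡id

∈⇒size≤d₀ : ∀ {D 𝒟} → D ∈ 𝒟 → size D ≤ d₀ 𝒟
∈⇒size≤d₀ {D} (here refl)       = m≤m+n (size D) _
∈⇒size≤d₀ {𝒟 = E ∷ _} (there p) = ≤-trans (∈⇒size≤d₀ p) (m≤n+m _ (size E))

antichain-obstruction-free : ∀ {𝒜 A G} → IsAntichain 𝒜 → 𝒜 A → G ⟶ A → ¬ (A ⟶ G) →
                             ∀ B → 𝒜 B → ¬ (B ⟶ G)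
antichain-obstruction-free {A = A} {G} anti A∈𝒜 r A↛G B B∈𝒜 h =
  anti B A B∈𝒜 A∈𝒜 (λ { refl → A↛G h }) (_⨾_ {B} {G} {A} h r)

module _ {𝒜 : Family} {𝒟 : List Graph} (dual : IsDualityPair 𝒜 𝒟) where

  obstruction↛dual : ∀ {A D} → 𝒜 A → D ∈ 𝒟 → ¬ (A ⟶ D)
  obstruction↛dual {A} {D} A∈𝒜 D∈𝒟 h =
    proj₂ (dual A) ((A , A∈𝒜 , idHom A) , (D , D∈𝒟 , h))

  obstruction-free⇒dual : ∀ {G} → (∀ A → 𝒜 A → ¬ (A ⟶ G)) → ∃[ D ] (D ∈ 𝒟 × (G ⟶ D))
  obstruction-free⇒dual {G} free with proj₁ (dual G)
  ... | inj₁ (A , A∈𝒜 , h) = ⊥-elim (free A A∈𝒜 h)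
  ... | inj₂ below-dual    = below-dual

module Splitting (A : Graph) (v : V A) where

  n : ℕ
  n = size A

  -- inj₁ u stands for the arc u → v and inj₂ u for the arc v → u, whether present in A or not.
  Arc : Set
  Arc = V A ⊎ V A

  _≟ₐ_ : DecidableEquality Arc
  _≟ₐ_ = ≡-dec _≟ᶠ_ _≟ᶠ_

  isArc : Arc → Bool
  isArc (inj₁ u) = lookup (lookup (adj A) u) v
  isArc (inj₂ u) = lookup (lookup (adj A) v) u

  Present : Arc → Set
  Present t = isArc t ≡ true

  present? : Decidable Present
  present? t = isArc t ≟ᵇ true

  arcs : List Arc
  arcs = map inj₁ (allFin n) ++ map inj₂ (allFin n)

  arcs-unique : Unique arcs
  arcs-unique = Unique.++⁺ (Unique.map⁺ inj₁-injective (Unique.allFin⁺ n))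
                           (Unique.map⁺ inj₂-injective (Unique.allFin⁺ n)) disjoint
    where
    disjoint : ∀ {t} → ¬ (t ∈ map inj₁ (allFin n) × t ∈ map inj₂ (allFin n))
    disjoint (p , q) with ∈-map⁻ inj₁ p | ∈-map⁻ inj₂ q
    ... | _ , _ , refl | _ , _ , ()

  totalDeg≡#present : totalDeg A v ≡ length (filter present? arcs)
  totalDeg≡#present = begin
    totalDeg A v
      ≡⟨ cong₂ _+_ (cong sum (map-∘ {g = ι} {f = inj₁} (allFin n)))
                   (cong sum (map-∘ {g = ι} {f = inj₂} (allFin n))) ⟩
    sum (map ι ins) + sum (map ι outs)
      ≡⟨ sym (sum-++ (map ι ins) (map ι outs)) ⟩
    sum (map ι ins ++ map ι outs)
      ≡⟨ cong sum (sym (map-++ ι ins outs)) ⟩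
    sum (map ι arcs)
      ≡⟨ sum-indicator≡length-filter isArc arcs ⟩
    length (filter present? arcs) ∎
    where
    open ≡-Reasoning
    ι : Arc → ℕ
    ι = indicator ∘ isArc
    ins outs : List Arc
    ins  = map inj₁ (allFin n)
    outs = map inj₂ (allFin n)

  -- The split graph keeps the vertices x ≢ v as inj₁ x and has a copy inj₂ c of v for each arc c,
  -- carrying every arc at v except c; inj₁ v and the copies of absent arcs are isolated.
  -- Allows p t says that p may carry (the lift of) the arc t.
  Vertex : Set
  Vertex = V A ⊎ Arc

  fold : Vertex → V A
  fold (inj₁ x) = x
  fold (inj₂ _) = v

  Allows : Vertex → Arc → Set
  Allows (inj₁ x) _ = x ≢ v
  Allows (inj₂ c) t = Present c × c ≢ t

  allows? : ∀ p t → Dec (Allows p t)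
  allows? (inj₁ x) _ = ¬? (x ≟ᶠ v)
  allows? (inj₂ c) t = present? c ×-dec ¬? (c ≟ₐ t)

  SplitEdge : Vertex → Vertex → Set
  SplitEdge p q = Edge A (fold p) (fold q) × Allows p (inj₂ (fold q)) × Allows q (inj₁ (fold p))

  splitEdge? : ∀ p q → Dec (SplitEdge p q)
  splitEdge? p q = (lookup (lookup (adj A) (fold p)) (fold q) ≟ᵇ true)
                   ×-dec allows? p _ ×-dec allows? q _

  no-vertex-allows-all : ∀ t → Present t → (p : Vertex) → fold p ≡ v →
                         ¬ (∀ s → Present s → Allows p s)
  no-vertex-allows-all t t-present (inj₁ x) x≡v allows-all = allows-all t t-present x≡v
  no-vertex-allows-all t t-present (inj₂ c) _   allows-all =
    proj₂ (allows-all c (proj₁ (allows-all t t-present))) refl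

  N : ℕ
  N = n + (n + n)

  decode : Fin N → Vertex
  decode i = Sum.map₂ (splitAt n) (splitAt n i)

  encode : Vertex → Fin N
  encode p = join n (n + n) (Sum.map₂ (join n n) p)

  decode-encode : ∀ p → decode (encode p) ≡ p
  decode-encode (inj₁ x) = cong (Sum.map₂ (splitAt n)) (splitAt-join n (n + n) (inj₁ x))
  decode-encode (inj₂ t) =
    trans (cong (Sum.map₂ (splitAt n)) (splitAt-join n (n + n) (inj₂ (join n n t))))
          (cong inj₂ (splitAt-join n n t))

  split : Graph
  split = decGraph N (λ i j → splitEdge? (decode i) (decode j))

  Edge-split⁻ : ∀ {i j} → Edge split i j → SplitEdge (decode i) (decode j)
  Edge-split⁻ = Edge-decGraph⁻ N (λ i j → splitEdge? (decode i) (decode j))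

  Edge-split⁺ : ∀ {p q} → SplitEdge p q → Edge split (encode p) (encode q)
  Edge-split⁺ {p} {q} e = Edge-decGraph⁺ N (λ i j → splitEdge? (decode i) (decode j))
    (subst₂ SplitEdge (sym (decode-encode p)) (sym (decode-encode q)) e)

  fold-hom : IsHom split A (fold ∘ decode)
  fold-hom _ _ e = proj₁ (Edge-split⁻ e)

  A↛split : IsCore A → ∀ t → Present t → ¬ (A ⟶ split)
  A↛split core t t-present h with core⇒section {A} {split} core h (fold ∘ decode , fold-hom)
  ... | (s , s-hom) , section =
    no-vertex-allows-all t t-present (ψ v) (section v) allows-all
    where
    ψ : V A → Vertex
    ψ = decode ∘ s
    ψ-hom : ∀ {x y} → Edge A x y → SplitEdge (ψ x) (ψ y)
    ψ-hom e = Edge-split⁻ (s-hom _ _ e)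
    allows-all : ∀ t → Present t → Allows (ψ v) t
    allows-all (inj₁ u) e = subst (Allows (ψ v) ∘ inj₁) (section u) (proj₂ (proj₂ (ψ-hom e)))
    allows-all (inj₂ u) e = subst (Allows (ψ v) ∘ inj₂) (section u) (proj₁ (proj₂ (ψ-hom e)))

  module _ {D : Graph} (h : split ⟶ D) where

    copyImage : Arc → V D
    copyImage c = proj₁ h (encode (inj₂ c))

    merge : ∀ c₁ c₂ → c₁ ≢ c₂ → Present c₁ → Present c₂ → copyImage c₁ ≡ copyImage c₂ → A ⟶ D
    merge c₁ c₂ c₁≢c₂ c₁-present c₂-present same-image = f , f-hom
      where
      G : Vertex → V D
      G = proj₁ h ∘ encode

      G-hom : ∀ {p q} → SplitEdge p q → Edge D (G p) (G q)
      G-hom e = proj₂ h _ _ (Edge-split⁺ e)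

      -- v is sent to the common image of c₁ and c₂, and every arc at v is avoided by one of them.
      copyAvoiding : ∀ t → Σ[ c ∈ Arc ] Allows (inj₂ c) t × G (inj₂ c) ≡ G (inj₂ c₁)
      copyAvoiding t with c₁ ≟ₐ t
      ... | yes refl = c₂ , (c₂-present , c₁≢c₂ ∘ sym) , sym same-image
      ... | no c₁≢t  = c₁ , (c₁-present , c₁≢t) , refl

      image : ∀ x → Dec (x ≡ v) → V D
      image x (yes _) = G (inj₂ c₁)
      image x (no _)  = G (inj₁ x)

      f : V A → V D
      f x = image x (x ≟ᶠ v)

      lift : ∀ x (x≟v : Dec (x ≡ v)) t → Σ[ p ∈ Vertex ] fold p ≡ x × Allows p t × G p ≡ image x x≟v
      lift x (yes refl) t with copyAvoiding t
      ... | c , c-allows , same = inj₂ c , refl , c-allows , same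
      lift x (no x≢v) t = inj₁ x , refl , x≢v , refl

      f-hom : IsHom A D f
      f-hom x y e with lift x (x ≟ᶠ v) (inj₂ y) | lift y (y ≟ᶠ v) (inj₁ x)
      ... | p , refl , p-allows , Gp≡fx | q , refl , q-allows , Gq≡fy =
        subst₂ (Edge D) Gp≡fx Gq≡fy (G-hom (e , p-allows , q-allows))

    copyImage-injective : ¬ (A ⟶ D) → ∀ {c₁ c₂} → Present c₁ → Present c₂ →
                          copyImage c₁ ≡ copyImage c₂ → c₁ ≡ c₂
    copyImage-injective A↛D {c₁} {c₂} c₁-present c₂-present same-image with c₁ ≟ₐ c₂
    ... | yes c₁≡c₂ = c₁≡c₂
    ... | no c₁≢c₂  = ⊥-elim (A↛D (merge c₁ c₂ c₁≢c₂ c₁-present c₂-present same-image))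

lemma7 : (𝒜 : Family) (𝒟 : List Graph) →
    IsDualityPair 𝒜 𝒟 → IsAntichain 𝒜 → (∀ A → 𝒜 A → IsCore A) →
    ∀ A → 𝒜 A → (v : V A) → totalDeg A v ≤ d₀ 𝒟
lemma7 𝒜 𝒟 dual antichain cores A A∈𝒜 v =
  subst (_≤ d₀ 𝒟) (sym totalDeg≡#present)
    (length-filter≤-from-witness present? arcs (λ {t} → bound t))
  where
  open Splitting A v

  bound : ∀ t → Present t → length (filter present? arcs) ≤ d₀ 𝒟
  bound t t-present with obstruction-free⇒dual dual {split} split-obstruction-free
    where
    split-obstruction-free : ∀ B → 𝒜 B → ¬ (B ⟶ split)
    split-obstruction-free = antichain-obstruction-free {𝒜} {A} {split} antichain A∈𝒜
      (fold ∘ decode , fold-hom) (A↛split (cores A A∈𝒜) t t-present)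
  ... | D , D∈𝒟 , h =
    ≤-trans (length-filter≤ present? (copyImage {D} h) copies-injective arcs-unique) (∈⇒size≤d₀ D∈𝒟)
    where
    copies-injective : ∀ {c₁ c₂} → Present c₁ → Present c₂ →
                       copyImage {D} h c₁ ≡ copyImage {D} h c₂ → c₁ ≡ c₂
    copies-injective = copyImage-injective {D} h (obstruction↛dual dual {A} {D} A∈𝒜 D∈𝒟)
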